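{- Let $I$ be a set of positive integers and let $\ell$ be a positive integer with $\ell\notin I$. Then there is no formula $\varphi\in\mathcal L_A(I)$ that is equivalent to $[A_\ell]p$ (for a propositional variable $p$).
   Context: Bimodal Kripke models $M=(W,R_1,R_2,\Pi)$, pointed models $(M,w)$. For a word $s=s_1\dots s_l\in\{1,2\}^*$, $w'$ is an $s$-successor of $w$ if there are $w=w_0,\dots,w_l=w'$ with $(w_{k-1},w_k)\in R_{s_k}$. A language $L\subseteq\{1,2\}^*$ yields the operator $[L]$: $M,w\models[L]\varphi$ iff $M,w'\models\varphi$ for every $s$-successor $w'$ of $w$ with $s\in L$. For $\ell\ge1$, $a^\ell_1$ and $a^\ell_2$ are the words of length $\ell$ over $\{1,2\}$ in which consecutive letters differ, starting with $1$ resp. $2$, and $A_\ell=\{a^\ell_1,a^\ell_2\}$. For a set $I$ of positive integers, $\mathcal L_A(I)$ is the logic with formulas $\varphi::=p\mid\neg\varphi\mid\varphi\vee\varphi\mid[A_k]\varphi$ ($k\in I$). Formulas are equivalent if they hold at the same pointed models. -}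

module Defs where

open import Data.Nat using (ℕ; zero; suc)
open import Data.List using (List; []; _∷_)
open import Data.Product using (Σ; _×_; _,_)
open import Data.Sum using (_⊎_)
open import Relation.Nullary using (¬_)
open import Relation.Binary.PropositionalEquality using (_≡_)

data Idx : Set where
  one two : Idx

other : Idx → Idx
other one = two
other two = one

Word : Set
Word = List Idx

record Model : Set₁ where
  field
    W  : Set
    R₁ : W → W → Set
    R₂ : W → W → Set
    Π  : ℕ → W → Set

open Model public

Rel : (M : Model) → Idx → W M → W M → Set
Rel M one = R₁ M
Rel M two = R₂ M

data Succ (M : Model) : Word → W M → W M → Set where
  done : ∀ {w} → Succ M [] w w
  step : ∀ {i s w v w'} → Rel M i w v → Succ M s v w' → Succ M (i ∷ s) w w'

Lang : Set₁
Lang = Word → Set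

Box : (M : Model) → Lang → (W M → Set) → W M → Set
Box M L φ w = ∀ s → L s → ∀ w' → Succ M s w w' → φ w'

alt : Idx → ℕ → Word
alt a zero = []
alt a (suc n) = a ∷ alt (other a) n

A : ℕ → Lang
A ℓ s = (s ≡ alt one ℓ) ⊎ (s ≡ alt two ℓ)

data Form (I : ℕ → Set) : Set where
  var  : ℕ → Form I
  neg  : Form I → Form I
  or   : Form I → Form I → Form I
  boxA : (k : ℕ) → I k → Form I → Form I

_,_⊨_ : ∀ {I} (M : Model) → W M → Form I → Set
M , w ⊨ var p      = Π M p w
M , w ⊨ neg φ      = ¬ (M , w ⊨ φ)
M , w ⊨ or φ ψ     = (M , w ⊨ φ) ⊎ (M , w ⊨ ψ)
M , w ⊨ boxA k _ φ = Box M (A k) (λ v → M , v ⊨ φ) w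

module Submission where

-- Let full ℓ be the chain 0 → 1 → ⋯ → ℓ whose edges carry both letters, with every variable
-- false exactly at ℓ; the alternating path of length ℓ from 0 refutes [A_ℓ]p there. Colour
-- the edges alternately (colour x on edge x → x+1) and obtain pruned m (ℓ = m+1) by letting
-- the first edge carry only the off-colour letter and the last edge only the colour letter.
-- An alternating path from 0 is then forced out of phase and can never cross the last edge,
-- so [A_ℓ]p holds at 0. Yet every alternating path of full ℓ of length k ≠ ℓ survives in
-- pruned m along some alternating word: in phase when it starts away from 0, out of phase
-- when it starts at 0 (it then stops before the last edge). Hence the identity is an
-- A_I-bisimulation and no formula of L_A(I) separates the two models at 0.

open import Defs
open import Data.Nat using (ℕ; zero; suc; _+_; _≤_; _<_; z≤n; s≤s; s≤s⁻¹)
open import Data.Nat.Properties using (+-suc; +-identityʳ; m≤n+m; ≤-trans; ≤-reflexive; <⇒≢; ≤∧≢⇒<)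
open import Data.Product using (Σ; ∃; ∃₂; _×_; _,_; proj₁)
open import Data.Sum using (inj₁; inj₂)
open import Data.Empty using (⊥-elim)
open import Relation.Nullary using (¬_)
open import Relation.Binary.PropositionalEquality using (_≡_; _≢_; refl; sym; trans; subst)
open import Function.Bundles using (_⇔_; mk⇔; Equivalence)
open import Function.Construct.Identity using (⇔-id)
open import Function.Related.TypeIsomorphisms using (¬-cong-⇔)
open import Data.Sum.Function.Propositional using (_⊎-⇔_)

open Equivalence using (to; from)

other-≢ : ∀ a → other a ≢ a
other-≢ one ()
other-≢ two ()

alt∈A : ∀ a k → A k (alt a k)
alt∈A one k = inj₁ refl
alt∈A two k = inj₂ refl

A⇒alt : ∀ {k s} → A k s → ∃ λ a → s ≡ alt a k
A⇒alt (inj₁ s≡alt) = one , s≡alt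
A⇒alt (inj₂ s≡alt) = two , s≡alt

record ABisimulation (I : ℕ → Set) (M N : Model) : Set₁ where
  field
    _∼_   : W M → W N → Set
    atoms : ∀ {v w} → v ∼ w → ∀ p → Π M p v ⇔ Π N p w
    forth : ∀ {k s v v′ w} → I k → v ∼ w → A k s → Succ M s v v′ →
            ∃₂ λ s′ w′ → A k s′ × Succ N s′ w w′ × v′ ∼ w′
    back  : ∀ {k s′ v w w′} → I k → v ∼ w → A k s′ → Succ N s′ w w′ →
            ∃₂ λ s v′ → A k s × Succ M s v v′ × v′ ∼ w′

module _ {I : ℕ → Set} {M N : Model} (B : ABisimulation I M N) where
  open ABisimulation B

  ⊨-invariant : ∀ (φ : Form I) {v w} → v ∼ w → (M , v ⊨ φ) ⇔ (N , w ⊨ φ)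
  ⊨-invariant (var p)       v∼w = atoms v∼w p
  ⊨-invariant (neg φ)       v∼w = ¬-cong-⇔ (⊨-invariant φ v∼w)
  ⊨-invariant (or φ ψ)      v∼w = ⊨-invariant φ v∼w ⊎-⇔ ⊨-invariant ψ v∼w
  ⊨-invariant (boxA k Ik φ) v∼w = mk⇔
    (λ □φ s′ s′∈A w′ q → let (s , v′ , s∈A , p , v′∼w′) = back Ik v∼w s′∈A q
                         in to (⊨-invariant φ v′∼w′) (□φ s s∈A v′ p))
    (λ □φ s s∈A v′ p → let (s′ , w′ , s′∈A , q , v′∼w′) = forth Ik v∼w s∈A p
                       in from (⊨-invariant φ v′∼w′) (□φ s′ s′∈A w′ q))

data Step (E : ℕ → Idx → Set) (i : Idx) : ℕ → ℕ → Set where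
  edge : ∀ {x} → E x i → Step E i x (suc x)

chain : ℕ → (ℕ → Idx → Set) → Model
chain ℓ E = record { W = ℕ ; R₁ = Step E one ; R₂ = Step E two ; Π = λ _ x → x ≢ ℓ }

step-of-rel : ∀ {ℓ E} i {x y} → Rel (chain ℓ E) i x y → Step E i x y
step-of-rel one r = r
step-of-rel two r = r

rel-of-step : ∀ {ℓ E} i {x y} → Step E i x y → Rel (chain ℓ E) i x y
rel-of-step one r = r
rel-of-step two r = r

module _ {ℓ : ℕ} {E : ℕ → Idx → Set} where

  chain-forward : ∀ {s v w} → Succ (chain ℓ E) s v w → v ≤ w
  chain-forward done = ≤-reflexive refl
  chain-forward (step {i = i} r rest) with step-of-rel i r
  ... | edge _ = ≤-trans (m≤n+m _ 1) (chain-forward rest)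

  alt-path-end : ∀ {a k j w} → Succ (chain ℓ E) (alt a k) j w → w ≡ k + j
  alt-path-end {k = zero} done = refl
  alt-path-end {a} {suc k} {j} (step r rest) with step-of-rel a r
  ... | edge _ = trans (alt-path-end rest) (+-suc k j)

  chain-mono : ∀ {F : ℕ → Idx → Set} → (∀ {x i} → E x i → F x i) →
               ∀ {s v w} → Succ (chain ℓ E) s v w → Succ (chain ℓ F) s v w
  chain-mono E⊆F done = done
  chain-mono E⊆F (step {i = i} r rest) with step-of-rel i r
  ... | edge e = step (rel-of-step i (edge (E⊆F e))) (chain-mono E⊆F rest)

full : ℕ → Model
full ℓ = chain ℓ (λ x _ → x < ℓ)

module _ {ℓ : ℕ} where

  full-path-bounded : ∀ {s v w} → v ≤ ℓ → Succ (full ℓ) s v w → w ≤ ℓ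
  full-path-bounded v≤ℓ done = v≤ℓ
  full-path-bounded _ (step {i = i} r rest) with step-of-rel i r
  ... | edge v<ℓ = full-path-bounded v<ℓ rest

  full-alt-path : ∀ a k {j} → k + j ≤ ℓ → Succ (full ℓ) (alt a k) j (k + j)
  full-alt-path a zero _ = done
  full-alt-path a (suc k) {j} k+j<ℓ =
    step (rel-of-step a (edge (≤-trans (s≤s (m≤n+m j k)) k+j<ℓ)))
      (subst (Succ (full ℓ) (alt (other a) k) (suc j)) (+-suc k j)
        (full-alt-path (other a) k (subst (_≤ ℓ) (sym (+-suc k j)) k+j<ℓ)))

  full-□-fails : ∀ p → ¬ Box (full ℓ) (A ℓ) (Π (full ℓ) p) 0
  full-□-fails p □p =
    □p (alt one ℓ) (alt∈A one ℓ) (ℓ + 0)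
       (full-alt-path one ℓ (≤-reflexive (+-identityʳ ℓ))) (+-identityʳ ℓ)

colour : ℕ → Idx
colour zero    = two
colour (suc x) = other (colour x)

Allowed : ℕ → ℕ → Idx → Set
Allowed m x i = x < suc m × (x ≡ 0 → i ≡ other (colour x)) × (x ≡ m → i ≡ colour x)

pruned : ℕ → Model
pruned m = chain (suc m) (Allowed m)

-- Since colour (suc j) = other (colour j), a word alt (colour j) or alt (other (colour j))
-- read from j continues from suc j as a word of the same kind, definitionally.
module _ {m : ℕ} where

  pruned-edge : ∀ i {x} → Allowed m x i → Rel (pruned m) i x (suc x)
  pruned-edge i allowed = rel-of-step i (edge allowed)

  in-phase : ∀ {a k j w} → Succ (full (suc m)) (alt a k) (suc j) w →
             Succ (pruned m) (alt (colour (suc j)) k) (suc j) w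
  in-phase {a} {zero} done = done
  in-phase {a} {suc k} {j} (step r rest) with step-of-rel a r
  ... | edge j<ℓ = step (pruned-edge (colour (suc j)) (j<ℓ , (λ ()) , λ _ → refl))
                        (in-phase rest)

  out-of-phase : ∀ {a k j w} → w ≤ m → Succ (full (suc m)) (alt a k) j w →
                 Succ (pruned m) (alt (other (colour j)) k) j w
  out-of-phase {a} {zero} _ done = done
  out-of-phase {a} {suc k} {j} w≤m (step r rest) with step-of-rel a r
  ... | edge j<ℓ = step (pruned-edge (other (colour j)) (j<ℓ , (λ _ → refl) , j≢m))
                        (out-of-phase w≤m rest)
    where
    j≢m : j ≡ m → other (colour j) ≡ colour j
    j≢m j≡m = ⊥-elim (<⇒≢ (≤-trans (chain-forward rest) w≤m) j≡m)

  out-of-phase-bounded : ∀ {k j w} → j ≤ m → Succ (pruned m) (alt (other (colour j)) k) j w → w ≤ m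
  out-of-phase-bounded {zero} j≤m done = j≤m
  out-of-phase-bounded {suc k} {j} _ (step r rest) with step-of-rel (other (colour j)) r
  ... | edge (j<ℓ , _ , last) =
    out-of-phase-bounded (≤∧≢⇒< (s≤s⁻¹ j<ℓ) (λ j≡m → other-≢ (colour j) (last j≡m))) rest

  pruned-origin-bounded : ∀ {a k w} → Succ (pruned m) (alt a k) 0 w → w ≤ m
  pruned-origin-bounded {one} p = out-of-phase-bounded z≤n p
  pruned-origin-bounded {two} {zero} done = z≤n
  pruned-origin-bounded {two} {suc k} (step (edge (_ , first , _)) _) with first refl
  ... | ()

  pruned-□ : ∀ k p → Box (pruned m) (A k) (Π (pruned m) p) 0
  pruned-□ k p s s∈A w q with A⇒alt s∈A
  ... | a , refl = <⇒≢ (s≤s (pruned-origin-bounded q))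

  full-to-pruned : ∀ {a k j w} → k ≢ suc m → Succ (full (suc m)) (alt a k) j w →
                   ∃ λ b → Succ (pruned m) (alt b k) j w
  full-to-pruned {j = suc j} _ p = colour (suc j) , in-phase p
  full-to-pruned {k = k} {zero} {w} k≢ℓ p = one , out-of-phase w≤m p
    where
    w≡k : w ≡ k
    w≡k = trans (alt-path-end p) (+-identityʳ k)
    w≤m : w ≤ m
    w≤m = s≤s⁻¹ (≤∧≢⇒< (full-path-bounded z≤n p) (λ w≡ℓ → k≢ℓ (trans (sym w≡k) w≡ℓ)))

  full-pruned-bisimulation : ∀ {I : ℕ → Set} → ¬ I (suc m) → ABisimulation I (full (suc m)) (pruned m)
  full-pruned-bisimulation {I} ¬Iℓ = record
    { _∼_   = _≡_
    ; atoms = λ { refl _ → ⇔-id _ }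
    ; forth = forth
    ; back  = λ { _ refl s∈A q → _ , _ , s∈A , chain-mono proj₁ q , refl }
    }
    where
    forth : ∀ {k s v v′ w} → I k → v ≡ w → A k s → Succ (full (suc m)) s v v′ →
            ∃₂ λ s′ w′ → A k s′ × Succ (pruned m) s′ w w′ × v′ ≡ w′
    forth Ik refl s∈A p with A⇒alt s∈A
    ... | a , refl with full-to-pruned (λ { refl → ¬Iℓ Ik }) p
    ... | b , q = alt b _ , _ , alt∈A b _ , q , refl

theorem8 : (I : ℕ → Set) → (∀ k → I k → 0 < k) →
    (ℓ : ℕ) → 0 < ℓ → ¬ I ℓ → (p : ℕ) →
    ¬ Σ (Form I) (λ φ → (M : Model) (w : W M) →
    (M , w ⊨ φ) ⇔ Box M (A ℓ) (Π M p) w)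
theorem8 _ _ zero () _ _
theorem8 _ _ (suc m) _ ¬Iℓ p (φ , φ⇔□p) = full-□-fails p □p-full
  where
  φ-pruned : pruned m , 0 ⊨ φ
  φ-pruned = from (φ⇔□p (pruned m) 0) (pruned-□ (suc m) p)
  □p-full : Box (full (suc m)) (A (suc m)) (Π (full (suc m)) p) 0
  □p-full = to (φ⇔□p (full (suc m)) 0)
               (from (⊨-invariant (full-pruned-bisimulation ¬Iℓ) φ refl) φ-pruned)
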